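{- Let $G_s$ be a strongly connected digraph with start vertex $s$, let $r$ be either a marked vertex of $G_s$ or $s$, and let $H_r=H(G_s,r)$. Let $z$ be a marked vertex of $G_s$ with $d(z)\in T(r)$, so that $(d(z),z)$ is an edge of $H_r$. Then in $H_r\setminus(d(z),z)$, $r$ can reach every vertex of $H_r$ other than $z$ and (if $r\neq s$) $d(r)$, and $z$ is unreachable from $r$.
   Context: Digraphs may have multiple edges. For a strongly connected digraph $G_s$ with start vertex $s$: $u$ dominates $v$ if every path from $s$ to $v$ contains $u$; the dominator tree $D(G_s)$ is rooted at $s$ with $u$ an ancestor of $v$ iff $u$ dominates $v$; $d(v)$ is the parent of $v\ne s$, $D(r)$ the set of descendants of $r$. An edge $(u,v)$ is a bridge of $G_s$ if every path from $s$ to $v$ uses it; then $v$ is marked. Deleting from $D(G_s)$ the edges $(d(v),v)$ for all marked $v$ splits it into subtrees; $T(r)$ is the subtree rooted at $r$. The auxiliary graph $H(G_s,r)$ is obtained from $G_s$ by contracting, for every marked $z$ with $d(z)\in T(r)$, the set $D(z)$ into the vertex $z$, and, if $r\neq s$, contracting $V(G_s)\setminus D(r)$ into the vertex $d(r)$; resulting self-loops are removed and every edge of multiplicity at least two is kept with multiplicity two. -}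

module Defs where

open import Data.Nat using (ℕ)
open import Data.Fin using (Fin)
open import Data.Product using (Σ; _×_; ∃)
open import Data.Sum using (_⊎_)
open import Relation.Nullary using (¬_)
open import Relation.Binary.PropositionalEquality using (_≡_; _≢_)
open import Relation.Binary.Construct.Closure.ReflexiveTransitive using (Star)

record Graph (n : ℕ) : Set where
  field
    m  : ℕ
    tl : Fin m → Fin n
    hd : Fin m → Fin n
open Graph public

module _ {n : ℕ} (G : Graph n) where

  data Walk : Fin n → Fin n → Set where
    []  : ∀ {v} → Walk v v
    _∷_ : ∀ {w} (e : Fin (m G)) → Walk (hd G e) w → Walk (tl G e) w

  _∈V_ : ∀ {a b} → Fin n → Walk a b → Set
  _∈V_ {a} u [] = u ≡ a
  u ∈V (e ∷ p) = (u ≡ tl G e) ⊎ (u ∈V p)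

  _∈E_ : ∀ {a b} → Fin (m G) → Walk a b → Set
  f ∈E [] = Data.Empty.⊥ where import Data.Empty
  f ∈E (e ∷ p) = (f ≡ e) ⊎ (f ∈E p)

  StronglyConnected : Set
  StronglyConnected = ∀ u v → Walk u v

  module _ (s : Fin n) where

    Dom : Fin n → Fin n → Set
    Dom u v = (p : Walk s v) → u ∈V p

    IDom : Fin n → Fin n → Set
    IDom u v = (u ≢ v) × Dom u v × (∀ w → Dom w v → w ≢ v → Dom w u)

    Bridge : Fin (m G) → Set
    Bridge e = (p : Walk s (hd G e)) → e ∈E p

    Marked : Fin n → Set
    Marked v = Σ (Fin (m G)) λ e → (hd G e ≡ v) × Bridge e

    -- v ∈ T(r): v is a descendant of r in the dominator tree and the tree path
    -- from r to v contains no marked vertex other than r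
    InT : Fin n → Fin n → Set
    InT r v = Dom r v × (∀ w → Marked w → Dom r w → Dom w v → w ≡ r)

    -- z is a marked vertex with d(z) ∈ T(r) (its set D(z) is contracted into z in H(G_s,r))
    Collapsed : Fin n → Fin n → Set
    Collapsed r z = Marked z × ∃ λ w → IDom w z × InT r w

    -- Rep r x y : in H(G_s,r), the original vertex x becomes the vertex y
    Rep : Fin n → Fin n → Fin n → Set
    Rep r x y =
        (Collapsed r y × Dom y x)
      ⊎ ((r ≢ s × ¬ Dom r x) × IDom y r)
      ⊎ (y ≡ x × (∀ z → Collapsed r z → ¬ Dom z x) × (r ≡ s ⊎ Dom r x))

    HVertex : Fin n → Fin n → Set
    HVertex r y = ∃ λ x → Rep r x y

    -- edge e of G_s becomes an edge (a,b) of H(G_s,r) (a ≢ b: self-loops removed)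
    EdgeTo : Fin n → Fin (m G) → Fin n → Fin n → Set
    EdgeTo r e a b = Rep r (tl G e) a × Rep r (hd G e) b

    -- (a,b) is an edge of H(G_s,r) ∖ (p,q), where one copy of the edge (p,q) is
    -- deleted: multiplicities are capped at two, so (p,q) survives the deletion
    -- iff it had at least two copies in H, i.e. at least two original edges map to it.
    HEdgeMinus : Fin n → Fin n → Fin n → Fin n → Fin n → Set
    HEdgeMinus r p q a b =
      (a ≢ b) × Σ (Fin (m G)) λ e → EdgeTo r e a b ×
        ((a ≡ p × b ≡ q) → Σ (Fin (m G)) λ e' → (e' ≢ e) × EdgeTo r e' a b)

    ReachMinus : Fin n → Fin n → Fin n → Fin n → Fin n → Set
    ReachMinus r p q = Star (HEdgeMinus r p q)

module Submission where

-- All vertices of H(G_s,r) other than z and d(r) are images of vertices x of D(r) outside D(z).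
-- Cutting a walk from s to x that avoids z at its last visit of r gives a walk from r to x
-- inside D(r) and outside D(z); its image in H_r never uses the edge (d(z), z), since that
-- would put one of its vertices into D(z). Conversely, D(z) is entered in G only through the
-- bridge (d(z), z), so H_r has a single copy of (d(z), z) and no other edge into z.
-- Dominance is decidable by a finite search for avoiding walks, which makes the classical
-- case distinctions of the argument available.

open import Defs
open import Data.Nat using (ℕ; zero; suc; _≤_; _<_)
open import Data.Nat.Properties using (≤-trans; ≤-pred; ≤-reflexive)
open import Data.Fin using (Fin; _≟_)
open import Data.Fin.Properties using (any?; all?)
open import Data.Product using (Σ; _×_; ∃; _,_; proj₁; proj₂)
open import Data.Sum using (_⊎_; inj₁; inj₂)
open import Data.Empty using (⊥-elim)
open import Data.List using (List; length; filter; allFin)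
open import Data.List.Properties using (filter-notAll; length-tabulate)
open import Data.List.Membership.Propositional using (_∈_)
open import Data.List.Membership.Propositional.Properties using (∈-filter⁻; ∈-filter⁺; ∈-allFin)
import Data.List.Relation.Unary.Any as Any
open import Function using (id; _∘_)
open import Relation.Unary using (Decidable)
open import Relation.Nullary using (¬_; Dec; yes; no)
open import Relation.Nullary.Decidable using (_×-dec_; _⊎-dec_; _→-dec_; ¬?; map′; decidable-stable)
open import Relation.Binary.PropositionalEquality using (_≡_; _≢_; refl; sym; trans; subst)
open import Relation.Binary.Construct.Closure.ReflexiveTransitive using (Star; ε; _◅_)

module WalkProperties {n : ℕ} (G : Graph n) where

  infixr 5 _++_
  infix 4 _∈ᵥ_ _∈ₑ_ _⊆ₑ_

  _∈ᵥ_ : ∀ {a b} → Fin n → Walk G a b → Set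
  u ∈ᵥ p = _∈V_ G u p

  _∈ₑ_ : ∀ {a b} → Fin (m G) → Walk G a b → Set
  f ∈ₑ p = _∈E_ G f p

  _⊆ₑ_ : ∀ {a b c d} → Walk G a b → Walk G c d → Set
  q ⊆ₑ p = ∀ f → f ∈ₑ q → f ∈ₑ p

  NotEntered : ∀ {a b} → Fin n → Walk G a b → Set
  NotEntered u p = ∀ f → f ∈ₑ p → hd G f ≢ u

  NotLeft : ∀ {a b} → Fin n → Walk G a b → Set
  NotLeft u p = ∀ f → f ∈ₑ p → tl G f ≢ u

  NotEntered-⊆ₑ : ∀ {a b c d u} {q : Walk G a b} {p : Walk G c d} → q ⊆ₑ p → NotEntered u p → NotEntered u q
  NotEntered-⊆ₑ q⊆p ne f = ne f ∘ q⊆p f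

  NotLeft-⊆ₑ : ∀ {a b c d u} {q : Walk G a b} {p : Walk G c d} → q ⊆ₑ p → NotLeft u p → NotLeft u q
  NotLeft-⊆ₑ q⊆p nl f = nl f ∘ q⊆p f

  _++_ : ∀ {a b c} → Walk G a b → Walk G b c → Walk G a c
  [] ++ q = q
  (e ∷ p) ++ q = e ∷ (p ++ q)

  start-∈ᵥ : ∀ {a b} (p : Walk G a b) → a ∈ᵥ p
  start-∈ᵥ [] = refl
  start-∈ᵥ (e ∷ p) = inj₁ refl

  end-∈ᵥ : ∀ {a b} (p : Walk G a b) → b ∈ᵥ p
  end-∈ᵥ [] = refl
  end-∈ᵥ (e ∷ p) = inj₂ (end-∈ᵥ p)

  tl-∈ᵥ : ∀ {a b} (p : Walk G a b) {f} → f ∈ₑ p → tl G f ∈ᵥ p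
  tl-∈ᵥ (e ∷ p) (inj₁ refl) = inj₁ refl
  tl-∈ᵥ (e ∷ p) (inj₂ f∈p) = inj₂ (tl-∈ᵥ p f∈p)

  hd-∈ᵥ : ∀ {a b} (p : Walk G a b) {f} → f ∈ₑ p → hd G f ∈ᵥ p
  hd-∈ᵥ (e ∷ p) (inj₁ refl) = inj₂ (start-∈ᵥ p)
  hd-∈ᵥ (e ∷ p) (inj₂ f∈p) = inj₂ (hd-∈ᵥ p f∈p)

  hd-∈ᵥ-tail : ∀ {b} e (p : Walk G (hd G e) b) {f} → f ∈ₑ e ∷ p → hd G f ∈ᵥ p
  hd-∈ᵥ-tail e p (inj₁ refl) = start-∈ᵥ p
  hd-∈ᵥ-tail e p (inj₂ f∈p) = hd-∈ᵥ p f∈p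

  ∈ᵥ⇒start⊎hd : ∀ {a b x} (p : Walk G a b) → x ∈ᵥ p →
    x ≡ a ⊎ ∃ λ f → f ∈ₑ p × hd G f ≡ x
  ∈ᵥ⇒start⊎hd [] x∈p = inj₁ x∈p
  ∈ᵥ⇒start⊎hd (e ∷ p) (inj₁ x≡a) = inj₁ x≡a
  ∈ᵥ⇒start⊎hd (e ∷ p) (inj₂ x∈p) with ∈ᵥ⇒start⊎hd p x∈p
  ... | inj₁ x≡hd = inj₂ (e , inj₁ refl , sym x≡hd)
  ... | inj₂ (f , f∈p , hd≡x) = inj₂ (f , inj₂ f∈p , hd≡x)

  ∈ᵥ⇒end⊎tl : ∀ {a b x} (p : Walk G a b) → x ∈ᵥ p →
    x ≡ b ⊎ ∃ λ f → f ∈ₑ p × tl G f ≡ x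
  ∈ᵥ⇒end⊎tl [] x∈p = inj₁ x∈p
  ∈ᵥ⇒end⊎tl (e ∷ p) (inj₁ x≡tl) = inj₂ (e , inj₁ refl , sym x≡tl)
  ∈ᵥ⇒end⊎tl (e ∷ p) (inj₂ x∈p) with ∈ᵥ⇒end⊎tl p x∈p
  ... | inj₁ x≡b = inj₁ x≡b
  ... | inj₂ (f , f∈p , tl≡x) = inj₂ (f , inj₂ f∈p , tl≡x)

  NotEntered⇒start : ∀ {a b u} (p : Walk G a b) → NotEntered u p → u ∈ᵥ p → u ≡ a
  NotEntered⇒start p ne u∈p with ∈ᵥ⇒start⊎hd p u∈p
  ... | inj₁ u≡a = u≡a
  ... | inj₂ (f , f∈p , hd≡u) = ⊥-elim (ne f f∈p hd≡u)

  NotLeft⇒end : ∀ {a b u} (p : Walk G a b) → NotLeft u p → u ∈ᵥ p → u ≡ b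
  NotLeft⇒end p nl u∈p with ∈ᵥ⇒end⊎tl p u∈p
  ... | inj₁ u≡b = u≡b
  ... | inj₂ (f , f∈p , tl≡u) = ⊥-elim (nl f f∈p tl≡u)

  ∈ᵥ-++⁻ : ∀ {a b c x} (p : Walk G a b) (q : Walk G b c) → x ∈ᵥ p ++ q → x ∈ᵥ p ⊎ x ∈ᵥ q
  ∈ᵥ-++⁻ [] q x∈ = inj₂ x∈
  ∈ᵥ-++⁻ (e ∷ p) q (inj₁ x≡tl) = inj₁ (inj₁ x≡tl)
  ∈ᵥ-++⁻ (e ∷ p) q (inj₂ x∈) with ∈ᵥ-++⁻ p q x∈
  ... | inj₁ x∈p = inj₁ (inj₂ x∈p)
  ... | inj₂ x∈q = inj₂ x∈q

  ∈ₑ-++⁻ : ∀ {a b c f} (p : Walk G a b) (q : Walk G b c) → f ∈ₑ p ++ q → f ∈ₑ p ⊎ f ∈ₑ q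
  ∈ₑ-++⁻ [] q f∈ = inj₂ f∈
  ∈ₑ-++⁻ (e ∷ p) q (inj₁ f≡e) = inj₁ (inj₁ f≡e)
  ∈ₑ-++⁻ (e ∷ p) q (inj₂ f∈) with ∈ₑ-++⁻ p q f∈
  ... | inj₁ f∈p = inj₁ (inj₂ f∈p)
  ... | inj₂ f∈q = inj₂ f∈q

  _∈ᵥ?_ : ∀ {a b} u (p : Walk G a b) → Dec (u ∈ᵥ p)
  _∈ᵥ?_ {a} u [] = u ≟ a
  u ∈ᵥ? (e ∷ p) = (u ≟ tl G e) ⊎-dec (u ∈ᵥ? p)

  _∈ₑ?_ : ∀ {a b} f (p : Walk G a b) → Dec (f ∈ₑ p)
  f ∈ₑ? [] = no λ ()
  f ∈ₑ? (e ∷ p) = (f ≟ e) ⊎-dec (f ∈ₑ? p)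

  suffix-from-last : ∀ {a b u} (p : Walk G a b) → u ∈ᵥ p →
    Σ (Walk G u b) λ q → q ⊆ₑ p × NotEntered u q
  suffix-from-last [] refl = [] , (λ _ ()) , (λ _ ())
  suffix-from-last (e ∷ p) (inj₂ u∈p) with suffix-from-last p u∈p
  ... | q , q⊆p , ne = q , (λ f → inj₂ ∘ q⊆p f) , ne
  suffix-from-last (e ∷ p) (inj₁ refl) with tl G e ∈ᵥ? p
  ... | yes tl∈p with suffix-from-last p tl∈p
  ...   | q , q⊆p , ne = q , (λ f → inj₂ ∘ q⊆p f) , ne
  suffix-from-last (e ∷ p) (inj₁ refl) | no tl∉p =
    e ∷ p , (λ _ → id) , λ f f∈ hd≡tl → tl∉p (subst (_∈ᵥ p) hd≡tl (hd-∈ᵥ-tail e p f∈))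

  prefix-to-first : ∀ {a b u} (p : Walk G a b) → u ∈ᵥ p →
    Σ (Walk G a u) λ q → q ⊆ₑ p × NotLeft u q
  prefix-to-first [] refl = [] , (λ _ ()) , (λ _ ())
  prefix-to-first {u = u} (e ∷ p) u∈ with u ≟ tl G e
  ... | yes refl = [] , (λ _ ()) , (λ _ ())
  prefix-to-first (e ∷ p) (inj₁ u≡tl) | no u≢tl = ⊥-elim (u≢tl u≡tl)
  prefix-to-first (e ∷ p) (inj₂ u∈p) | no u≢tl with prefix-to-first p u∈p
  ... | q , q⊆p , nl =
    e ∷ q ,
    (λ { f (inj₁ f≡e) → inj₁ f≡e ; f (inj₂ f∈q) → inj₂ (q⊆p f f∈q) }) ,
    (λ { f (inj₁ refl) tl≡u → u≢tl (sym tl≡u) ; f (inj₂ f∈q) → nl f f∈q })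

  ∈ᵥ-⊆ₑ-suffix : ∀ {a b u x} (p : Walk G a b) (q : Walk G u b) → u ∈ᵥ p → q ⊆ₑ p →
    x ∈ᵥ q → x ∈ᵥ p
  ∈ᵥ-⊆ₑ-suffix p q u∈p q⊆p x∈q with ∈ᵥ⇒start⊎hd q x∈q
  ... | inj₁ refl = u∈p
  ... | inj₂ (f , f∈q , refl) = hd-∈ᵥ p (q⊆p f f∈q)

  ∈ᵥ-⊆ₑ-prefix : ∀ {a b u x} (p : Walk G a b) (q : Walk G a u) → u ∈ᵥ p → q ⊆ₑ p →
    x ∈ᵥ q → x ∈ᵥ p
  ∈ᵥ-⊆ₑ-prefix p q u∈p q⊆p x∈q with ∈ᵥ⇒end⊎tl q x∈q
  ... | inj₁ refl = u∈p
  ... | inj₂ (f , f∈q , refl) = tl-∈ᵥ p (q⊆p f f∈q)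

-- Depth-first search: a walk inside the vertex list A that is not trivial can be cut at the
-- last visit of its start, which leaves a first edge into A minus the start and a walk there.
module WalkSearch {n : ℕ} (G : Graph n) {Q : Fin (m G) → Set} (Q? : Decidable Q) where
  open WalkProperties G
  open import Data.List.Membership.DecPropositional (_≟_ {n}) using (_∈?_)

  QWalk : Fin n → Fin n → Set
  QWalk a b = Σ (Walk G a b) λ p → ∀ f → f ∈ₑ p → Q f

  private
    Inside : ∀ {a b} → List (Fin n) → Walk G a b → Set
    Inside A p = ∀ f → f ∈ₑ p → Q f × hd G f ∈ A

    other-than : (a : Fin n) → Decidable (_≢ a)
    other-than a x = ¬? (x ≟ a)

    _∖_ : List (Fin n) → Fin n → List (Fin n)
    A ∖ a = filter (other-than a) A

    ∖-shorter : ∀ {a} A → a ∈ A → length (A ∖ a) < length A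
    ∖-shorter A a∈A = filter-notAll (other-than _) A (Any.map (λ a≡x x≢a → x≢a (sym a≡x)) a∈A)

    ∈-∖⁺ : ∀ {A a x} → x ∈ A → x ≢ a → x ∈ A ∖ a
    ∈-∖⁺ = ∈-filter⁺ (other-than _)

    ∈-∖⁻ : ∀ {A a x} → x ∈ A ∖ a → x ∈ A
    ∈-∖⁻ = proj₁ ∘ ∈-filter⁻ (other-than _)

    FirstStep : Fin n → Fin n → List (Fin n) → Fin (m G) → Set
    FirstStep a b A e = tl G e ≡ a × (Q e × hd G e ∈ A) × Σ (Walk G (hd G e) b) (Inside A)

    first-step : ∀ {a b} A → a ≢ b → (p : Walk G a b) → Inside A p → ∃ (FirstStep a b (A ∖ a))
    first-step A a≢b p inside with suffix-from-last p (start-∈ᵥ p)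
    ... | [] , _ , _ = ⊥-elim (a≢b refl)
    ... | e ∷ q , q⊆p , a-not-entered = e , refl , inside′ e (inj₁ refl) , q , λ f → inside′ f ∘ inj₂
      where
        inside′ : ∀ f → f ∈ₑ e ∷ q → Q f × hd G f ∈ A ∖ tl G e
        inside′ f f∈ = proj₁ (inside f (q⊆p f f∈)) , ∈-∖⁺ (proj₂ (inside f (q⊆p f f∈))) (a-not-entered f f∈)

    extend : ∀ {a b} A e → FirstStep a b (A ∖ a) e → Σ (Walk G a b) (Inside A)
    extend A e (refl , (qe , hd∈) , w , inside) =
      e ∷ w , λ { f (inj₁ refl) → qe , ∈-∖⁻ hd∈
                ; f (inj₂ f∈w) → proj₁ (inside f f∈w) , ∈-∖⁻ (proj₂ (inside f f∈w)) }

    mutual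
      inside? : ∀ k A → length A ≤ k → ∀ a b → a ∈ A → Dec (Σ (Walk G a b) (Inside A))
      inside? zero (_ List.∷ _) () a b a∈A
      inside? (suc k) A len a b a∈A with a ≟ b
      ... | yes refl = yes ([] , λ _ ())
      ... | no a≢b = map′ (λ (e , st) → extend A e st) (λ (p , inside) → first-step A a≢b p inside)
                          (any? (first-step? k A len a b a∈A))

      first-step? : ∀ k A → length A ≤ suc k → ∀ a b → a ∈ A → Decidable (FirstStep a b (A ∖ a))
      first-step? k A len a b a∈A e with tl G e ≟ a | Q? e ×-dec hd G e ∈? A ∖ a
      ... | yes tl≡a | yes (qe , hd∈) =
        map′ (λ w → tl≡a , (qe , hd∈) , w) (proj₂ ∘ proj₂)
             (inside? k (A ∖ a) (≤-pred (≤-trans (∖-shorter A a∈A) len)) (hd G e) b hd∈)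
      ... | no tl≢a | _ = no (tl≢a ∘ proj₁)
      ... | _ | no ¬step = no (¬step ∘ proj₁ ∘ proj₂)

  QWalk? : ∀ a b → Dec (QWalk a b)
  QWalk? a b =
    map′ (λ (p , inside) → p , λ f → proj₁ ∘ inside f)
         (λ (p , q) → p , λ f f∈ → q f f∈ , ∈-allFin (hd G f))
         (inside? n (allFin n) (≤-reflexive (length-tabulate id)) a b (∈-allFin a))

module Dominators {n : ℕ} (G : Graph n) (s : Fin n) (sc : StronglyConnected G) where
  open WalkProperties G

  avoiding? : ∀ u a b → Dec (Σ (Walk G a b) λ p → ¬ u ∈ᵥ p)
  avoiding? u a b with a ≟ u
  ... | yes refl = no λ (p , u∉p) → u∉p (start-∈ᵥ p)
  ... | no a≢u =
    map′ (λ (p , ne) → p , u∉ p a≢u ne)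
         (λ (p , u∉p) → p , λ f f∈ hd≡u → u∉p (subst (_∈ᵥ p) hd≡u (hd-∈ᵥ p f∈)))
         (WalkSearch.QWalk? G (λ f → ¬? (hd G f ≟ u)) a b)
    where
      u∉ : ∀ {a} (p : Walk G a b) → a ≢ u → NotEntered u p → ¬ u ∈ᵥ p
      u∉ p a≢u ne u∈p = a≢u (sym (NotEntered⇒start p ne u∈p))

  Dom⊎avoiding : ∀ u v → Dom G s u v ⊎ Σ (Walk G s v) λ p → ¬ u ∈ᵥ p
  Dom⊎avoiding u v with avoiding? u s v
  ... | yes avoiding = inj₂ avoiding
  ... | no ¬avoiding = inj₁ λ p → decidable-stable (u ∈ᵥ? p) λ u∉p → ¬avoiding (p , u∉p)

  Dom? : ∀ u v → Dec (Dom G s u v)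
  Dom? u v with Dom⊎avoiding u v
  ... | inj₁ u-dom-v = yes u-dom-v
  ... | inj₂ (p , u∉p) = no λ u-dom-v → u∉p (u-dom-v p)

  ¬Dom⇒avoiding : ∀ {u v} → ¬ Dom G s u v → Σ (Walk G s v) λ p → ¬ u ∈ᵥ p
  ¬Dom⇒avoiding {u} {v} ¬u-dom-v with Dom⊎avoiding u v
  ... | inj₁ u-dom-v = ⊥-elim (¬u-dom-v u-dom-v)
  ... | inj₂ avoiding = avoiding

  Dom-refl : ∀ {v} → Dom G s v v
  Dom-refl = end-∈ᵥ

  start-Dom : ∀ {v} → Dom G s s v
  start-Dom = start-∈ᵥ

  Dom-trans : ∀ {a b c} → Dom G s a b → Dom G s b c → Dom G s a c
  Dom-trans a-dom-b b-dom-c p with prefix-to-first p (b-dom-c p)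
  ... | q , q⊆p , _ = ∈ᵥ-⊆ₑ-prefix p q (b-dom-c p) q⊆p (a-dom-b q)

  -- On the shortest prefix of a walk to u that reaches v, the vertex v occurs only at the end.
  Dom-antisym : ∀ {u v} → Dom G s u v → Dom G s v u → u ≡ v
  Dom-antisym {u} {v} u-dom-v v-dom-u with prefix-to-first (sc s u) (v-dom-u (sc s u))
  ... | q , _ , v-not-left with prefix-to-first q (u-dom-v q)
  ...   | q′ , q′⊆q , _ = sym (NotLeft⇒end q′ (NotLeft-⊆ₑ q′⊆q v-not-left) (v-dom-u q′))

  -- If neither dominates the other, a walk to b avoiding a followed by the part of a walk
  -- to x after its last visit of b would reach x avoiding a, or vice versa.
  Dom-total : ∀ {a b x} → Dom G s a x → Dom G s b x → Dom G s a b ⊎ Dom G s b a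
  Dom-total {a} {b} {x} a-dom-x b-dom-x with Dom⊎avoiding a b
  ... | inj₁ a-dom-b = inj₁ a-dom-b
  ... | inj₂ (q , a∉q) = inj₂ λ p → decidable-stable (b ∈ᵥ? p) (b-on p)
    where
      b-on : (p : Walk G s a) → ¬ ¬ b ∈ᵥ p
      b-on p b∉p with suffix-from-last (sc s x) (b-dom-x (sc s x))
      ... | t , t⊆ , b-not-entered with ∈ᵥ-++⁻ q t (a-dom-x (q ++ t))
      ...   | inj₁ a∈q = a∉q a∈q
      ...   | inj₂ a∈t with suffix-from-last t a∈t
      ...     | t′ , t′⊆t , _ with ∈ᵥ-++⁻ p t′ (b-dom-x (p ++ t′))
      ...       | inj₁ b∈p = b∉p b∈p
      ...       | inj₂ b∈t′ = a∉q (subst (_∈ᵥ q)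
                    (NotEntered⇒start t′ (NotEntered-⊆ₑ t′⊆t b-not-entered) b∈t′) (end-∈ᵥ q))

  Dom-tl : ∀ {w} e → Dom G s w (hd G e) → w ≢ hd G e → Dom G s w (tl G e)
  Dom-tl e w-dom-hd w≢hd p with ∈ᵥ-++⁻ p (e ∷ []) (w-dom-hd (p ++ e ∷ []))
  ... | inj₁ w∈p = w∈p
  ... | inj₂ (inj₁ refl) = end-∈ᵥ p
  ... | inj₂ (inj₂ w≡hd) = ⊥-elim (w≢hd w≡hd)

  Bridge⇒tl≢hd : ∀ {e} → Bridge G s e → tl G e ≢ hd G e
  Bridge⇒tl≢hd {e} bridge tl≡hd with prefix-to-first (sc s (hd G e)) (end-∈ᵥ (sc s (hd G e)))
  ... | q , _ , hd-not-left = hd-not-left e (bridge q) tl≡hd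

  Bridge⇒tl-IDom : ∀ {e w} → Bridge G s e → IDom G s w (hd G e) → tl G e ≡ w
  Bridge⇒tl-IDom {e} bridge (w≢hd , w-dom-hd , below) =
    Dom-antisym (below (tl G e) tl-dom-hd (Bridge⇒tl≢hd bridge)) (Dom-tl e w-dom-hd w≢hd)
    where
      tl-dom-hd : Dom G s (tl G e) (hd G e)
      tl-dom-hd p = tl-∈ᵥ p (bridge p)

  Bridge-∈ₑ : ∀ {e v} → Bridge G s e → v ≡ hd G e → (p : Walk G s v) → e ∈ₑ p
  Bridge-∈ₑ bridge refl = bridge

  Bridge⇒unique-entry : ∀ {e₀} → Bridge G s e₀ → ∀ e →
    ¬ Dom G s (hd G e₀) (tl G e) → Dom G s (hd G e₀) (hd G e) → e ≡ e₀
  Bridge⇒unique-entry {e₀} bridge e ¬dom-tl dom-hd with ¬Dom⇒avoiding ¬dom-tl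
  ... | q , z∉q with ∈ᵥ-++⁻ q (e ∷ []) (dom-hd (q ++ e ∷ []))
  ...   | inj₁ z∈q = ⊥-elim (z∉q z∈q)
  ...   | inj₂ (inj₁ z≡tl) = ⊥-elim (z∉q (subst (_∈ᵥ q) (sym z≡tl) (end-∈ᵥ q)))
  ...   | inj₂ (inj₂ z≡hd) with ∈ₑ-++⁻ q (e ∷ []) (Bridge-∈ₑ bridge (sym z≡hd) (q ++ e ∷ []))
  ...     | inj₁ e₀∈q = ⊥-elim (z∉q (hd-∈ᵥ q e₀∈q))
  ...     | inj₂ (inj₁ e₀≡e) = sym e₀≡e

  Dom-along-unentered : ∀ {r t u} → Dom G s r t → (q : Walk G r t) → NotEntered r q →
    u ∈ᵥ q → Dom G s r u
  Dom-along-unentered {r} r-dom-t q r-not-entered u∈q w = decidable-stable (r ∈ᵥ? w) r-on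
    where
      r-on : ¬ ¬ r ∈ᵥ w
      r-on r∉w with suffix-from-last q u∈q
      ... | q′ , q′⊆q , _ with ∈ᵥ-++⁻ w q′ (r-dom-t (w ++ q′))
      ...   | inj₁ r∈w = r∉w r∈w
      ...   | inj₂ r∈q′ = r∉w (subst (_∈ᵥ w)
                (sym (NotEntered⇒start q′ (NotEntered-⊆ₑ q′⊆q r-not-entered) r∈q′)) (end-∈ᵥ w))

  ¬Dom-off-walk : ∀ {t u z} (p : Walk G s t) → ¬ z ∈ᵥ p → u ∈ᵥ p → ¬ Dom G s z u
  ¬Dom-off-walk p z∉p u∈p z-dom-u with prefix-to-first p u∈p
  ... | q , q⊆p , _ = z∉p (∈ᵥ-⊆ₑ-prefix p q u∈p q⊆p (z-dom-u q))

  walk-within-Dom-avoiding-Dom : ∀ {r z t} → Dom G s r t → ¬ Dom G s z t →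
    Σ (Walk G r t) λ q → ∀ u → u ∈ᵥ q → Dom G s r u × ¬ Dom G s z u
  walk-within-Dom-avoiding-Dom r-dom-t ¬z-dom-t with ¬Dom⇒avoiding ¬z-dom-t
  ... | p , z∉p with suffix-from-last p (r-dom-t p)
  ...   | q , q⊆p , r-not-entered =
    q , λ u u∈q → Dom-along-unentered r-dom-t q r-not-entered u∈q ,
                  ¬Dom-off-walk p z∉p (∈ᵥ-⊆ₑ-suffix p q (r-dom-t p) q⊆p u∈q)

  Bridge? : ∀ e → Dec (Bridge G s e)
  Bridge? e =
    map′ (λ ¬avoiding p → decidable-stable (e ∈ₑ? p) λ e∉p →
            ¬avoiding (p , λ f f∈ f≡e → e∉p (subst (_∈ₑ p) f≡e f∈)))
         (λ bridge (p , avoids) → avoids e (bridge p) refl)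
         (¬? (WalkSearch.QWalk? G (λ f → ¬? (f ≟ e)) s (hd G e)))

  Marked? : ∀ v → Dec (Marked G s v)
  Marked? v = any? λ e → (hd G e ≟ v) ×-dec Bridge? e

  IDom? : ∀ w v → Dec (IDom G s w v)
  IDom? w v =
    ¬? (w ≟ v) ×-dec Dom? w v ×-dec all? λ w′ → Dom? w′ v →-dec ¬? (w′ ≟ v) →-dec Dom? w′ w

  InT? : ∀ r v → Dec (InT G s r v)
  InT? r v = Dom? r v ×-dec all? λ w → Marked? w →-dec Dom? r w →-dec Dom? w v →-dec (w ≟ r)

  Collapsed? : ∀ r z → Dec (Collapsed G s r z)
  Collapsed? r z = Marked? z ×-dec any? λ w → IDom? w z ×-dec InT? r w

module Contraction {n : ℕ} (G : Graph n) (s : Fin n) (sc : StronglyConnected G) (r : Fin n) where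
  open WalkProperties G
  open Dominators G s sc

  Collapsed⇒Dom : ∀ {y} → Collapsed G s r y → Dom G s r y
  Collapsed⇒Dom (_ , w , (_ , w-dom-y , _) , (r-dom-w , _)) = Dom-trans r-dom-w w-dom-y

  ¬Collapsed-r : ¬ Collapsed G s r r
  ¬Collapsed-r (_ , w , (w≢r , w-dom-r , _) , (r-dom-w , _)) = w≢r (Dom-antisym w-dom-r r-dom-w)

  -- Distinct collapsed vertices dominate disjoint sets: a collapsed vertex strictly above
  -- another would be a marked vertex on the tree path from r.
  Collapsed-Dom⇒≡ : ∀ {a b} → Collapsed G s r a → Collapsed G s r b → Dom G s a b → a ≡ b
  Collapsed-Dom⇒≡ {a} {b} ca (_ , _ , (_ , _ , below) , (_ , tree-path)) a-dom-b with a ≟ b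
  ... | yes a≡b = a≡b
  ... | no a≢b = ⊥-elim (¬Collapsed-r (subst (Collapsed G s r) a≡r ca))
    where
      a≡r : a ≡ r
      a≡r = tree-path a (proj₁ ca) (Collapsed⇒Dom ca) (below a a-dom-b a≢b)

  Collapsed-Dom-common⇒≡ : ∀ {a b x} → Collapsed G s r a → Collapsed G s r b →
    Dom G s a x → Dom G s b x → a ≡ b
  Collapsed-Dom-common⇒≡ ca cb a-dom-x b-dom-x with Dom-total a-dom-x b-dom-x
  ... | inj₁ a-dom-b = Collapsed-Dom⇒≡ ca cb a-dom-b
  ... | inj₂ b-dom-a = sym (Collapsed-Dom⇒≡ cb ca b-dom-a)

  root⇒Dom : ∀ {x} → r ≡ s ⊎ Dom G s r x → Dom G s r x
  root⇒Dom (inj₁ refl) = start-Dom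
  root⇒Dom (inj₂ r-dom-x) = r-dom-x

  Rep-self : Rep G s r r r
  Rep-self = inj₂ (inj₂ (refl , (λ y cy y-dom-r → ¬Collapsed-r (subst (Collapsed G s r)
               (Dom-antisym y-dom-r (Collapsed⇒Dom cy)) cy)) , inj₂ Dom-refl))

  Rep-exists : ∀ {x} → Dom G s r x → ∃ (Rep G s r x)
  Rep-exists {x} r-dom-x with any? (λ y → Collapsed? r y ×-dec Dom? y x)
  ... | yes (y , cy , y-dom-x) = y , inj₁ (cy , y-dom-x)
  ... | no ¬collapsed =
    x , inj₂ (inj₂ (refl , (λ y cy y-dom-x → ¬collapsed (y , cy , y-dom-x)) , inj₂ r-dom-x))

  Rep-unique : ∀ {x a b} → Dom G s r x → Rep G s r x a → Rep G s r x b → a ≡ b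
  Rep-unique r-dom-x (inj₁ (ca , a-dom-x)) (inj₁ (cb , b-dom-x)) = Collapsed-Dom-common⇒≡ ca cb a-dom-x b-dom-x
  Rep-unique r-dom-x (inj₁ (ca , a-dom-x)) (inj₂ (inj₂ (_ , uncollapsed , _))) =
    ⊥-elim (uncollapsed _ ca a-dom-x)
  Rep-unique r-dom-x (inj₂ (inj₂ (_ , uncollapsed , _))) (inj₁ (cb , b-dom-x)) =
    ⊥-elim (uncollapsed _ cb b-dom-x)
  Rep-unique r-dom-x (inj₂ (inj₂ (a≡x , _))) (inj₂ (inj₂ (b≡x , _))) = trans a≡x (sym b≡x)
  Rep-unique r-dom-x (inj₂ (inj₁ ((_ , ¬r-dom-x) , _))) _ = ⊥-elim (¬r-dom-x r-dom-x)
  Rep-unique r-dom-x _ (inj₂ (inj₁ ((_ , ¬r-dom-x) , _))) = ⊥-elim (¬r-dom-x r-dom-x)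

Star-unentered : ∀ {A : Set} {R : A → A → Set} {x z} → (∀ {y} → ¬ R y z) → Star R x z → x ≡ z
Star-unentered ¬R ε = refl
Star-unentered ¬R (x→y ◅ y→⋆z) with Star-unentered ¬R y→⋆z
... | refl = ⊥-elim (¬R x→y)

module DeletedBridge {n : ℕ} (G : Graph n) (s : Fin n) (sc : StronglyConnected G) (r z dz : Fin n)
  (marked-z : Marked G s z) (dz-idom-z : IDom G s dz z) (dz∈T : InT G s r dz) where
  open WalkProperties G
  open Dominators G s sc
  open Contraction G s sc r

  HEdge : Fin n → Fin n → Set
  HEdge = HEdgeMinus G s r dz z

  z-collapsed : Collapsed G s r z
  z-collapsed = marked-z , dz , dz-idom-z , dz∈T

  z≢r : z ≢ r
  z≢r z≡r = ¬Collapsed-r (subst (Collapsed G s r) z≡r z-collapsed)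

  Rep-z⇒Dom : ∀ {x} → Rep G s r x z → Dom G s z x
  Rep-z⇒Dom (inj₁ (_ , z-dom-x)) = z-dom-x
  Rep-z⇒Dom (inj₂ (inj₁ ((_ , ¬r-dom-x) , (_ , z-dom-r , _)))) =
    ⊥-elim (z≢r (Dom-antisym z-dom-r (Collapsed⇒Dom z-collapsed)))
  Rep-z⇒Dom (inj₂ (inj₂ (refl , _))) = Dom-refl

  Dom⇒Rep-z : ∀ {x a} → Dom G s z x → Rep G s r x a → a ≡ z
  Dom⇒Rep-z z-dom-x (inj₁ (ca , a-dom-x)) = Collapsed-Dom-common⇒≡ ca z-collapsed a-dom-x z-dom-x
  Dom⇒Rep-z z-dom-x (inj₂ (inj₁ ((_ , ¬r-dom-x) , _))) =
    ⊥-elim (¬r-dom-x (Dom-trans (Collapsed⇒Dom z-collapsed) z-dom-x))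
  Dom⇒Rep-z z-dom-x (inj₂ (inj₂ (_ , uncollapsed , _))) =
    ⊥-elim (uncollapsed z z-collapsed z-dom-x)

  Rep-dz : ∀ {a} → Rep G s r dz a → a ≡ dz
  Rep-dz (inj₁ (ca , a-dom-dz)) = ⊥-elim (¬Collapsed-r (subst (Collapsed G s r)
    (proj₂ dz∈T _ (proj₁ ca) (Collapsed⇒Dom ca) a-dom-dz) ca))
  Rep-dz (inj₂ (inj₁ ((_ , ¬r-dom-dz) , _))) = ⊥-elim (¬r-dom-dz (proj₁ dz∈T))
  Rep-dz (inj₂ (inj₂ (a≡dz , _))) = a≡dz

  bridge-z : Fin (m G)
  bridge-z = proj₁ marked-z

  tl-bridge-z : tl G bridge-z ≡ dz
  tl-bridge-z = tl-bridge marked-z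
    where
      tl-bridge : (mk : Marked G s z) → tl G (proj₁ mk) ≡ dz
      tl-bridge (_ , refl , bridge) = Bridge⇒tl-IDom bridge dz-idom-z

  edge-into-z⇒bridge : ∀ {e y} → y ≢ z → EdgeTo G s r e y z → e ≡ bridge-z
  edge-into-z⇒bridge {e} y≢z (rep-tl , rep-hd) = unique marked-z
    where
      unique : (mk : Marked G s z) → e ≡ proj₁ mk
      unique (_ , refl , bridge) =
        Bridge⇒unique-entry bridge e (λ z-dom-tl → y≢z (Dom⇒Rep-z z-dom-tl rep-tl)) (Rep-z⇒Dom rep-hd)

  -- The only edge of G into D(z) is the bridge, whose tail is d(z); it yields a single copy of (d(z), z).
  ¬HEdge-into-z : ∀ {y} → ¬ HEdge y z
  ¬HEdge-into-z {y} (y≢z , e , edge , second-copy) with edge-into-z⇒bridge y≢z edge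
  ... | refl with second-copy (Rep-dz (subst (λ t → Rep G s r t y) tl-bridge-z (proj₁ edge)) , refl)
  ...   | e′ , e′≢e , edge′ = e′≢e (edge-into-z⇒bridge y≢z edge′)

  z-unreachable : ¬ Star HEdge r z
  z-unreachable r→⋆z = z≢r (sym (Star-unentered ¬HEdge-into-z r→⋆z))

  project : ∀ {y t a b} (w : Walk G y t) → (∀ u → u ∈ᵥ w → Dom G s r u × ¬ Dom G s z u) →
    Rep G s r y a → Rep G s r t b → Star HEdge a b
  project [] inside rep-a rep-b with Rep-unique (proj₁ (inside _ refl)) rep-a rep-b
  ... | refl = ε
  project {a = a} (e ∷ w) inside rep-a rep-b with Rep-exists (proj₁ (inside (hd G e) (inj₂ (start-∈ᵥ w))))
  ... | c , rep-c with a ≟ c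
  ...   | yes refl = project w (λ u → inside u ∘ inj₂) rep-c rep-b
  ...   | no a≢c = (a≢c , e , (rep-a , rep-c) , ⊥-elim ∘ c≢z ∘ proj₂)
                   ◅ project w (λ u → inside u ∘ inj₂) rep-c rep-b
    where
      c≢z : c ≢ z
      c≢z c≡z = proj₂ (inside (hd G e) (inj₂ (start-∈ᵥ w)))
                      (Rep-z⇒Dom (subst (Rep G s r (hd G e)) c≡z rep-c))

  reachable : ∀ v → HVertex G s r v → v ≢ z → (r ≢ s → ∀ dr → IDom G s dr r → v ≢ dr) →
    Star HEdge r v
  reachable v (_ , inj₂ (inj₁ ((r≢s , _) , v-idom-r))) _ v≢dr = ⊥-elim (v≢dr r≢s v v-idom-r refl)
  reachable v (_ , inj₁ (cv , _)) v≢z _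
    with walk-within-Dom-avoiding-Dom (Collapsed⇒Dom cv) (v≢z ∘ sym ∘ Collapsed-Dom⇒≡ z-collapsed cv)
  ... | q , inside = project q inside Rep-self (inj₁ (cv , Dom-refl))
  reachable v (x , rep@(inj₂ (inj₂ (_ , uncollapsed , r≡s⊎r-dom-x)))) _ _
    with walk-within-Dom-avoiding-Dom (root⇒Dom r≡s⊎r-dom-x) (uncollapsed z z-collapsed)
  ... | q , inside = project q inside Rep-self rep

lemma9 : ∀ {n} (G : Graph n) (s : Fin n) → StronglyConnected G →
    ∀ r → (Marked G s r ⊎ r ≡ s) →
    ∀ z dz → Marked G s z → IDom G s dz z → InT G s r dz →
    (∀ v → HVertex G s r v → v ≢ z →
       (r ≢ s → ∀ dr → IDom G s dr r → v ≢ dr) →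
       ReachMinus G s r dz z r v)
    × ¬ ReachMinus G s r dz z r z
lemma9 G s sc r _ z dz marked-z dz-idom-z dz∈T = reachable , z-unreachable
  where open DeletedBridge G s sc r z dz marked-z dz-idom-z dz∈T
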